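{- For any regular ordered ST-structure $\mathcal{S}$, one has $\mathsf{ST}(\mathsf{Sc}(\mathcal{S}))\cong\mathcal{S}$ (isomorphism of ordered ST-structures). For any sculpture $em:Q\hookrightarrow B^d$, one has $\mathsf{Sc}(\mathsf{ST}(em))\cong em$ (isomorphism of sculptures).
   Context: Precubical sets: families of disjoint sets $Q_n$ with face maps $s_k,t_k:Q_n\to Q_{n-1}$ ($k=1,\dots,n$) satisfying $\alpha_k\beta_\ell=\beta_{\ell-1}\alpha_k$ for $\alpha,\beta\in\{s,t\}$, $k<\ell$; morphisms commute with face maps. A higher-dimensional automaton (HDA) is a finite precubical set with an initial cell $I\in Q_0$; HDA morphisms are precubical morphisms preserving the initial cell; an embedding is an injective HDA morphism. The bulk $B^d$ is the HDA with $n$-cells the tuples in $\{0,\ast,1\}^d$ with exactly $n$ entries $\ast$, with $s_k$ (resp. $t_k$) replacing the $k$-th occurrence of $\ast$ by $0$ (resp. $1$), and initial cell $(0,\dots,0)$. A sculpture is an HDA $Q$ with an HDA embedding $em:Q\hookrightarrow B^d$. A morphism of sculptures $(Q,em,B^d)\to(Q',em',B^{d'})$ is a pair of HDA morphisms $f:Q\to Q'$, $b:B^d\to B^{d'}$ with $b\circ em=em'\circ f$; it is an isomorphism if $f$ and $b$ are isomorphisms. An ST-structure is a pair $(E,\Sigma)$ with $E$ a finite set of events and $\Sigma$ a set of ST-configurations, i.e. pairs $(S,T)$ with $T\subseteq S\subseteq E$. A morphism $(E,\Sigma)\to(E',\Sigma')$ is a partial function $f:E\rightharpoonup E'$ such that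 for every $(S,T)\in\Sigma$, $f$ restricted to $S$ is total and injective, and $(f(S),f(T))\in\Sigma'$. An ordered ST-structure has a totally ordered event set; morphisms of ordered ST-structures additionally satisfy $f(e_1)<f(e_2)$ whenever $e_1<e_2$ and both are defined; an isomorphism is a bijective morphism. Steps: $(S,T)\to(S\cup\{e\},T)$ for $e\notin S$, and $(S,T)\to(S,T\cup\{e\})$ for $e\in S\setminus T$. $(E,\Sigma)$ is regular if it is rooted ($(\emptyset,\emptyset)\in\Sigma$), connected (every element of $\Sigma$ is reachable from $(\emptyset,\emptyset)$ by a sequence of steps through elements of $\Sigma$), and closed under single events (for $(S,T)\in\Sigma$ and $e\in S\setminus T$, also $(S,T\cup\{e\})\in\Sigma$ and $(S\setminus\{e\},T)\in\Sigma$). For a regular ordered ST-structure $\mathcal S$ on events $e_1<\dots<e_d$, map each $(S,T)\in\Sigma$ to the tuple $x\in\{0,\ast,1\}^d$ with $x_i=0$ if $e_i\notin S$, $x_i=\ast$ if $e_i\in S\setminus T$, $x_i=1$ if $e_i\in T$; the image is a sub-HDA of $B^d$ (closed under faces, containing $(0,\dots,0)$), and $\mathsf{Sc}(\mathcal S)$ denotes this sub-HDA together with its inclusion into $B^d$. For a sculpture $em:Q\hookrightarrow B^d$, $\mathsf{ST}(em)$ is the ordered ST-structure on events $1<\dots<d$ whose configurations are $(\{i:em(q)_i\neq0\},\{i:em(q)_i=1\})$ for $q\in Q$. -}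

module Defs where

open import Data.Nat as ℕ using (ℕ; zero; suc; z≤n; s≤s)
open import Data.Nat.Properties as ℕP using ()
open import Data.Fin as Fin using (Fin; zero; suc; inject₁)
open import Data.Fin.Properties as FinP using ()
open import Data.Fin.Subset as Sub using (Subset; _∈_; _∉_; _⊆_; ⁅_⁆; _∪_; _-_; inside; outside)
open import Data.Fin.Subset.Properties using (_∈?_)
open import Data.Vec as Vec using (Vec; []; _∷_; tabulate; here; there)
open import Data.Vec.Properties as VecP using ()
open import Data.Bool as Bool using (Bool; true; false; T)
open import Data.Bool.Properties as BoolP using ()
open import Data.Maybe as Maybe using (Maybe; just; nothing)
open import Data.Maybe.Properties as MaybeP using ()
open import Data.List as List using (List; []; _∷_; _++_)
open import Data.List.Relation.Unary.Any as Any using (Any; here; there)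
open import Data.List.Membership.Propositional using () renaming (_∈_ to _∈L_)
open import Data.List.Membership.Propositional.Properties using (∈-map⁺; ∈-++⁺ˡ; ∈-++⁺ʳ)
open import Data.Product using (Σ; ∃; _×_; _,_; proj₁; proj₂)
open import Data.Unit using (tt)
open import Data.Empty using (⊥-elim)
open import Relation.Binary.PropositionalEquality
open import Relation.Nullary using (¬_; Dec; yes; no)
open import Relation.Nullary.Decidable using (⌊_⌋; _×-dec_; toWitness; fromWitness; T?)

-- Face maps s_k, t_k : Q_n → Q_{n-1} (k = 1..n) are indexed 0-based:
-- face α n k : Cell (suc n) → Cell n with k : Fin (suc n) standing for k+1.

data Dir : Set where
  src tgt : Dir

record Precubical : Set₁ where
  field
    Cell : ℕ → Set
    face : Dir → (n : ℕ) → Fin (suc n) → Cell (suc n) → Cell n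

-- α_k β_ℓ = β_{ℓ-1} α_k for k < ℓ.  With 0-based indices: k-1 = i,
-- ℓ-1 = suc j with i ≤ j (i.e. k < ℓ).
IsPrecubical : Precubical → Set
IsPrecubical P =
  ∀ (α β : Dir) (n : ℕ) (i j : Fin (suc n)) → i Fin.≤ j →
  (x : Cell (suc (suc n))) →
  face α n i (face β (suc n) (suc j) x) ≡ face β n j (face α (suc n) (inject₁ i) x)
  where open Precubical P

-- A finite type (constructively: Kuratowski-finite, given by a complete list).
Listed : Set → Set
Listed A = Σ (List A) λ xs → ∀ a → a ∈L xs

IsFinite : Precubical → Set
IsFinite P = (Σ ℕ λ N → ∀ n → N ℕ.≤ n → ¬ Cell n) × (∀ n → Listed (Cell n))
  where open Precubical P

record HDA : Set₁ where
  field
    pc     : Precubical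
  open Precubical pc public
  field
    laws   : IsPrecubical pc
    finite : IsFinite pc
    init   : Cell 0

record HDAHom (P Q : HDA) : Set where
  private
    module P = HDA P
    module Q = HDA Q
  field
    map      : ∀ n → P.Cell n → Q.Cell n
    comm     : ∀ α n k (x : P.Cell (suc n)) → map n (P.face α n k x) ≡ Q.face α n k (map (suc n) x)
    pres-init : map 0 P.init ≡ Q.init

open HDAHom public

IsEmbedding : ∀ {P Q} → HDAHom P Q → Set
IsEmbedding {P} f = ∀ n (x y : HDA.Cell P n) → map f n x ≡ map f n y → x ≡ y

IsIsoHDA : ∀ {P Q} → HDAHom P Q → Set
IsIsoHDA {P} {Q} f =
  Σ (HDAHom Q P) λ g → (∀ n x → map g n (map f n x) ≡ x) × (∀ n y → map f n (map g n y) ≡ y)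

-- The bulk B^d.  Cube d n = tuples in {0,∗,1}^d with exactly n entries ∗
-- (as an inductive family: c0 / c⋆ / c1 prepend the entry 0 / ∗ / 1).

data Cube : ℕ → ℕ → Set where
  []  : Cube 0 0
  c0  : ∀ {d n} → Cube d n → Cube (suc d) n
  c⋆  : ∀ {d n} → Cube d n → Cube (suc d) (suc n)
  c1  : ∀ {d n} → Cube d n → Cube (suc d) n

endpt : Dir → ∀ {d n} → Cube d n → Cube (suc d) n
endpt src c = c0 c
endpt tgt c = c1 c

-- s_k / t_k: replace the k-th ∗ by 0 / 1.
cface : Dir → ∀ {d n} → Fin (suc n) → Cube d (suc n) → Cube d n
cface α k (c0 c) = c0 (cface α k c)
cface α k (c1 c) = c1 (cface α k c)
cface α zero (c⋆ c) = endpt α c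
cface α {n = suc n} (suc k) (c⋆ c) = c⋆ (cface α k c)
cface α {n = zero} (suc ()) (c⋆ c)

zeros : ∀ d → Cube d 0
zeros zero = []
zeros (suc d) = c0 (zeros d)

cface-endpt : ∀ α β {d n} (j : Fin (suc n)) (c : Cube d (suc n)) →
              cface β j (endpt α c) ≡ endpt α (cface β j c)
cface-endpt src β j c = refl
cface-endpt tgt β j c = refl

cube-law : ∀ (α β : Dir) {d} (n : ℕ) (i j : Fin (suc n)) → i Fin.≤ j →
           (x : Cube d (suc (suc n))) →
           cface α i (cface β (suc j) x) ≡ cface β j (cface α (inject₁ i) x)
cube-law α β n i j le (c0 x) = cong c0 (cube-law α β n i j le x)
cube-law α β n i j le (c1 x) = cong c1 (cube-law α β n i j le x)
cube-law α β n zero j le (c⋆ x) = sym (cface-endpt α β j x)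
cube-law α β (suc n) (suc i) (suc j) (s≤s le) (c⋆ x) = cong c⋆ (cube-law α β n i j le x)

cube-bound : ∀ {d n} → Cube d n → n ℕ.≤ d
cube-bound [] = z≤n
cube-bound (c0 c) = ℕP.m≤n⇒m≤1+n (cube-bound c)
cube-bound (c⋆ c) = s≤s (cube-bound c)
cube-bound (c1 c) = ℕP.m≤n⇒m≤1+n (cube-bound c)

allCubes : ∀ d n → List (Cube d n)
stars : ∀ d n → List (Cube (suc d) n)
allCubes zero zero = [] ∷ []
allCubes zero (suc n) = []
allCubes (suc d) n = List.map c0 (allCubes d n) ++ (stars d n ++ List.map c1 (allCubes d n))
stars d zero = []
stars d (suc n) = List.map c⋆ (allCubes d n)

allCubes-complete : ∀ {d n} (c : Cube d n) → c ∈L allCubes d n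
allCubes-complete [] = here refl
allCubes-complete (c0 c) = ∈-++⁺ˡ (∈-map⁺ c0 (allCubes-complete c))
allCubes-complete {suc d} {suc n} (c⋆ c) =
  ∈-++⁺ʳ (List.map c0 (allCubes d (suc n))) (∈-++⁺ˡ (∈-map⁺ c⋆ (allCubes-complete c)))
allCubes-complete {suc d} {n} (c1 c) =
  ∈-++⁺ʳ (List.map c0 (allCubes d n)) (∈-++⁺ʳ (stars d n) (∈-map⁺ c1 (allCubes-complete c)))

bulkPC : ℕ → Precubical
bulkPC d = record { Cell = Cube d ; face = λ α n k c → cface α k c }

Bulk : ℕ → HDA
Bulk d = record
  { pc = bulkPC d
  ; laws = λ α β n i j le x → cube-law α β n i j le x
  ; finite = (suc d , λ n le c → ℕP.<⇒≱ (s≤s (cube-bound c)) le)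
           , (λ n → allCubes d n , allCubes-complete)
  ; init = zeros d
  }

record Sculpture : Set₁ where
  field
    Q      : HDA
    dim    : ℕ
    em     : HDAHom Q (Bulk dim)
    em-inj : IsEmbedding em

record SculptureHom (X Y : Sculpture) : Set where
  private
    module X = Sculpture X
    module Y = Sculpture Y
  field
    f    : HDAHom X.Q Y.Q
    b    : HDAHom (Bulk X.dim) (Bulk Y.dim)
    comm : ∀ n x → map b n (map X.em n x) ≡ map Y.em n (map f n x)

_≅Sc_ : Sculpture → Sculpture → Set
X ≅Sc Y = Σ (SculptureHom X Y) λ h → IsIsoHDA (SculptureHom.f h) × IsIsoHDA (SculptureHom.b h)

-- Ordered ST-structures.  The events e_1 < … < e_d are the elements of
-- Fin d with their natural order; a set of configurations Σ is given by
-- its characteristic function on pairs of subsets.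

record OrdST : Set where
  field
    d      : ℕ
    Conf   : Subset d → Subset d → Bool
    conf-⊆ : ∀ X Y → T (Conf X Y) → Y ⊆ X

open OrdST public

image : ∀ {d d'} → (Fin d → Maybe (Fin d')) → Subset d → Subset d'
image f X = tabulate λ e' →
  ⌊ FinP.any? (λ e → (e ∈? X) ×-dec MaybeP.≡-dec FinP._≟_ (f e) (just e')) ⌋

record OrdSTHom (A B : OrdST) : Set where
  field
    fun   : Fin (d A) → Maybe (Fin (d B))
    total : ∀ X Y → T (Conf A X Y) → ∀ e → e ∈ X → ∃ λ e' → fun e ≡ just e'
    inj   : ∀ X Y → T (Conf A X Y) → ∀ e₁ e₂ → e₁ ∈ X → e₂ ∈ X → fun e₁ ≡ fun e₂ → e₁ ≡ e₂
    conf  : ∀ X Y → T (Conf A X Y) → T (Conf B (image fun X) (image fun Y))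
    mono  : ∀ e₁ e₂ e₁' e₂' → e₁ Fin.< e₂ → fun e₁ ≡ just e₁' → fun e₂ ≡ just e₂' → e₁' Fin.< e₂'

_≅ST_ : OrdST → OrdST → Set
A ≅ST B = Σ (OrdSTHom A B) λ h → let f = OrdSTHom.fun h in
  (∀ e → ∃ λ e' → f e ≡ just e') ×
  (∀ e₁ e₂ → f e₁ ≡ f e₂ → e₁ ≡ e₂) ×
  (∀ e' → ∃ λ e → f e ≡ just e')

Rooted : OrdST → Set
Rooted A = T (Conf A Sub.⊥ Sub.⊥)

data Reach (A : OrdST) : Subset (d A) → Subset (d A) → Set where
  root  : T (Conf A Sub.⊥ Sub.⊥) → Reach A Sub.⊥ Sub.⊥
  start : ∀ {X Y e} → Reach A X Y → e ∉ X → T (Conf A (X ∪ ⁅ e ⁆) Y) → Reach A (X ∪ ⁅ e ⁆) Y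
  term  : ∀ {X Y e} → Reach A X Y → e ∈ X → e ∉ Y → T (Conf A X (Y ∪ ⁅ e ⁆)) → Reach A X (Y ∪ ⁅ e ⁆)

Connected : OrdST → Set
Connected A = ∀ X Y → T (Conf A X Y) → Reach A X Y

ClosedSingle : OrdST → Set
ClosedSingle A = ∀ X Y e → T (Conf A X Y) → e ∈ X → e ∉ Y →
  T (Conf A X (Y ∪ ⁅ e ⁆)) × T (Conf A (X - e) Y)

record Regular (A : OrdST) : Set where
  field
    rooted    : Rooted A
    connected : Connected A
    closed    : ClosedSingle A

-- Tuples ↔ configurations: for a tuple x, S_x = {i : x_i ≠ 0},
-- T_x = {i : x_i = 1}.

Sof : ∀ {d n} → Cube d n → Subset d
Sof [] = []
Sof (c0 c) = outside ∷ Sof c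
Sof (c⋆ c) = inside ∷ Sof c
Sof (c1 c) = inside ∷ Sof c

Tof : ∀ {d n} → Cube d n → Subset d
Tof [] = []
Tof (c0 c) = outside ∷ Tof c
Tof (c⋆ c) = outside ∷ Tof c
Tof (c1 c) = inside ∷ Tof c

Tof⊆Sof : ∀ {d n} (c : Cube d n) → Tof c ⊆ Sof c
Tof⊆Sof (c⋆ c) (there p) = there (Tof⊆Sof c p)
Tof⊆Sof (c0 c) (there p) = there (Tof⊆Sof c p)
Tof⊆Sof (c1 c) here = here
Tof⊆Sof (c1 c) (there p) = there (Tof⊆Sof c p)

Sof-zeros : ∀ d → Sof (zeros d) ≡ Sub.⊥
Sof-zeros zero = refl
Sof-zeros (suc d) = cong (outside ∷_) (Sof-zeros d)

Tof-zeros : ∀ d → Tof (zeros d) ≡ Sub.⊥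
Tof-zeros zero = refl
Tof-zeros (suc d) = cong (outside ∷_) (Tof-zeros d)

starPos : ∀ {d n} → Fin (suc n) → Cube d (suc n) → Fin d
starPos k (c0 c) = suc (starPos k c)
starPos k (c1 c) = suc (starPos k c)
starPos zero (c⋆ c) = zero
starPos {n = suc n} (suc k) (c⋆ c) = suc (starPos k c)
starPos {n = zero} (suc ()) (c⋆ c)

∪⊥ : ∀ {d} (X : Subset d) → X ∪ Sub.⊥ ≡ X
∪⊥ [] = refl
∪⊥ (x ∷ X) = cong₂ _∷_ (BoolP.∨-identityʳ x) (∪⊥ X)

─⊥ : ∀ {d} (X : Subset d) → X Sub.─ Sub.⊥ ≡ X
─⊥ [] = refl
─⊥ (x ∷ X) = cong (x ∷_) (─⊥ X)

Sof-src : ∀ {d n} (k : Fin (suc n)) (c : Cube d (suc n)) → Sof (cface src k c) ≡ Sof c - starPos k c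
Sof-src k (c0 c) = cong (outside ∷_) (Sof-src k c)
Sof-src k (c1 c) = cong (inside ∷_) (Sof-src k c)
Sof-src zero (c⋆ c) = cong (outside ∷_) (sym (─⊥ (Sof c)))
Sof-src {n = suc n} (suc k) (c⋆ c) = cong (inside ∷_) (Sof-src k c)

Tof-src : ∀ {d n} (k : Fin (suc n)) (c : Cube d (suc n)) → Tof (cface src k c) ≡ Tof c
Tof-src k (c0 c) = cong (outside ∷_) (Tof-src k c)
Tof-src k (c1 c) = cong (inside ∷_) (Tof-src k c)
Tof-src zero (c⋆ c) = refl
Tof-src {n = suc n} (suc k) (c⋆ c) = cong (outside ∷_) (Tof-src k c)

Sof-tgt : ∀ {d n} (k : Fin (suc n)) (c : Cube d (suc n)) → Sof (cface tgt k c) ≡ Sof c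
Sof-tgt k (c0 c) = cong (outside ∷_) (Sof-tgt k c)
Sof-tgt k (c1 c) = cong (inside ∷_) (Sof-tgt k c)
Sof-tgt zero (c⋆ c) = refl
Sof-tgt {n = suc n} (suc k) (c⋆ c) = cong (inside ∷_) (Sof-tgt k c)

Tof-tgt : ∀ {d n} (k : Fin (suc n)) (c : Cube d (suc n)) → Tof (cface tgt k c) ≡ Tof c ∪ ⁅ starPos k c ⁆
Tof-tgt k (c0 c) = cong (outside ∷_) (Tof-tgt k c)
Tof-tgt k (c1 c) = cong (inside ∷_) (Tof-tgt k c)
Tof-tgt zero (c⋆ c) = cong (inside ∷_) (sym (∪⊥ (Tof c)))
Tof-tgt {n = suc n} (suc k) (c⋆ c) = cong (outside ∷_) (Tof-tgt k c)

starPos∈S : ∀ {d n} (k : Fin (suc n)) (c : Cube d (suc n)) → starPos k c ∈ Sof c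
starPos∈S k (c0 c) = there (starPos∈S k c)
starPos∈S k (c1 c) = there (starPos∈S k c)
starPos∈S zero (c⋆ c) = here
starPos∈S {n = suc n} (suc k) (c⋆ c) = there (starPos∈S k c)

starPos∉T : ∀ {d n} (k : Fin (suc n)) (c : Cube d (suc n)) → starPos k c ∉ Tof c
starPos∉T k (c0 c) (there p) = starPos∉T k c p
starPos∉T k (c1 c) (there p) = starPos∉T k c p
starPos∉T zero (c⋆ c) ()
starPos∉T {n = suc n} (suc k) (c⋆ c) (there p) = starPos∉T k c p

noStar : ∀ {d} (c : Cube d 0) e → e ∈ Sof c → e ∉ Tof c → Data.Empty.⊥
noStar (c0 c) (suc e) (there p) q = noStar c e p (λ r → q (there r))
noStar (c1 c) zero here q = q here
noStar (c1 c) (suc e) (there p) q = noStar c e p (λ r → q (there r))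

findStar : ∀ {d n} (c : Cube d (suc n)) e → e ∈ Sof c → e ∉ Tof c → ∃ λ k → starPos k c ≡ e
findStar (c0 c) (suc e) (there p) q with findStar c e p (λ r → q (there r))
... | k , eq = k , cong suc eq
findStar (c1 c) zero here q = ⊥-elim (q here)
findStar (c1 c) (suc e) (there p) q with findStar c e p (λ r → q (there r))
... | k , eq = k , cong suc eq
findStar (c⋆ c) zero p q = zero , refl
findStar {n = zero} (c⋆ c) (suc e) (there p) q = ⊥-elim (noStar c e p (λ r → q (there r)))
findStar {n = suc n} (c⋆ c) (suc e) (there p) q with findStar c e p (λ r → q (there r))
... | k , eq = suc k , cong suc eq

T-irr : ∀ b (p q : T b) → p ≡ q
T-irr true tt tt = refl

Σ-T-≡ : ∀ {A : Set} {P : A → Bool} {a a' : A} (p : T (P a)) (p' : T (P a')) →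
        a ≡ a' → _≡_ {A = Σ A (λ x → T (P x))} (a , p) (a' , p')
Σ-T-≡ {P = P} {a} p p' refl = cong (a ,_) (T-irr (P a) p p')

filterT : ∀ {A : Set} (P : A → Bool) → List A → List (Σ A (λ x → T (P x)))
filterT P [] = []
filterT P (x ∷ xs) with T? (P x)
... | yes p = (x , p) ∷ filterT P xs
... | no _ = filterT P xs

filterT-complete : ∀ {A : Set} (P : A → Bool) (xs : List A) (a : A) (p : T (P a)) →
                   a ∈L xs → (a , p) ∈L filterT P xs
filterT-complete P (x ∷ xs) a p (here refl) with T? (P x)
... | yes p' = here (Σ-T-≡ {P = P} p p' refl)
... | no ¬p = ⊥-elim (¬p p)
filterT-complete P (x ∷ xs) a p (there m) with T? (P x)
... | yes p' = there (filterT-complete P xs a p m)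
... | no _ = filterT-complete P xs a p m

-- Sc(S): the sub-HDA of B^d consisting of the tuples x with
-- (S_x, T_x) ∈ Σ (= the image of Σ under (S,T) ↦ x), with its inclusion.
-- Defined for rooted ST-structures closed under single events
-- (which is what makes the image a sub-HDA; in particular for regular ones).

module ScCon (A : OrdST) (r : Rooted A) (cl : ClosedSingle A) where
  mem : ∀ {n} → Cube (d A) n → Bool
  mem c = Conf A (Sof c) (Tof c)

  Cell : ℕ → Set
  Cell n = Σ (Cube (d A) n) (λ c → T (mem c))

  closure : ∀ α {n} (k : Fin (suc n)) (c : Cube (d A) (suc n)) → T (mem c) → T (mem (cface α k c))
  closure src k c p = subst₂ (λ X Y → T (Conf A X Y)) (sym (Sof-src k c)) (sym (Tof-src k c))
    (proj₂ (cl (Sof c) (Tof c) (starPos k c) p (starPos∈S k c) (starPos∉T k c)))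
  closure tgt k c p = subst₂ (λ X Y → T (Conf A X Y)) (sym (Sof-tgt k c)) (sym (Tof-tgt k c))
    (proj₁ (cl (Sof c) (Tof c) (starPos k c) p (starPos∈S k c) (starPos∉T k c)))

  pc : Precubical
  pc = record { Cell = Cell ; face = λ α n k x → cface α k (proj₁ x) , closure α k (proj₁ x) (proj₂ x) }

  hda : HDA
  hda = record
    { pc = pc
    ; laws = λ α β n i j le x → Σ-T-≡ {P = mem} _ _ (cube-law α β n i j le (proj₁ x))
    ; finite = (suc (d A) , λ n le x → ℕP.<⇒≱ (s≤s (cube-bound (proj₁ x))) le)
             , (λ n → filterT mem (allCubes (d A) n)
                     , λ x → filterT-complete mem (allCubes (d A) n) (proj₁ x) (proj₂ x)
                                              (allCubes-complete (proj₁ x)))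
    ; init = zeros (d A) , subst₂ (λ X Y → T (Conf A X Y)) (sym (Sof-zeros (d A))) (sym (Tof-zeros (d A))) r
    }

  em : HDAHom hda (Bulk (d A))
  em = record { map = λ n → proj₁ ; comm = λ α n k x → refl ; pres-init = refl }

  sculpture : Sculpture
  sculpture = record
    { Q = hda ; dim = d A ; em = em
    ; em-inj = λ n x y eq → Σ-T-≡ {P = mem} (proj₂ x) (proj₂ y) eq }

Sc : (A : OrdST) → Rooted A → ClosedSingle A → Sculpture
Sc A r cl = ScCon.sculpture A r cl

-- ST(em): configurations (S_{em q}, T_{em q}) for q ∈ Q.

module STCon (X : Sculpture) where
  open Sculpture X
  open HDA Q using (Cell; face; finite; init)

  N : ℕ
  N = proj₁ (proj₁ finite)

  cellsBelow : ℕ → List (Σ ℕ Cell)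
  cellsBelow zero = []
  cellsBelow (suc m) = List.map (m ,_) (proj₁ (proj₂ finite m)) ++ cellsBelow m

  cellsBelow-complete : ∀ m n (q : Cell n) → n ℕ.< m → (n , q) ∈L cellsBelow m
  cellsBelow-complete (suc m) n q (s≤s le) with n ℕ.≟ m
  ... | yes refl = ∈-++⁺ˡ (∈-map⁺ (n ,_) (proj₂ (proj₂ finite n) q))
  ... | no neq = ∈-++⁺ʳ (List.map (m ,_) (proj₁ (proj₂ finite m)))
                   (cellsBelow-complete m n q (ℕP.≤∧≢⇒< le neq))

  allCells : List (Σ ℕ Cell)
  allCells = cellsBelow N

  allCells-complete : ∀ n (q : Cell n) → (n , q) ∈L allCells
  allCells-complete n q with n ℕ.<? N
  ... | yes lt = cellsBelow-complete N n q lt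
  ... | no nlt = ⊥-elim (proj₂ (proj₁ finite) n (ℕP.≮⇒≥ nlt) q)

  Matches : Subset dim → Subset dim → Σ ℕ Cell → Set
  Matches S T' (n , q) = (Sof (map em n q) ≡ S) × (Tof (map em n q) ≡ T')

  matches? : ∀ S T' (x : Σ ℕ Cell) → Dec (Matches S T' x)
  matches? S T' (n , q) = VecP.≡-dec BoolP._≟_ (Sof (map em n q)) S
                   ×-dec VecP.≡-dec BoolP._≟_ (Tof (map em n q)) T'

  conf : Subset dim → Subset dim → Bool
  conf S T' = ⌊ Any.any? (matches? S T') allCells ⌋

  witness : ∀ S T' → T (conf S T') → ∃ (Matches S T')
  witness S T' p = Any.satisfied (toWitness p)

  lose : ∀ {S T'} (x : Σ ℕ Cell) → x ∈L allCells → Matches S T' x → T (conf S T')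
  lose x m mt = fromWitness (Any.map (λ { refl → mt }) m)

  st : OrdST
  st = record
    { d = dim
    ; Conf = conf
    ; conf-⊆ = λ S T' p → case (witness S T' p) }
    where
    case : ∀ {S T'} → ∃ (Matches S T') → T' ⊆ S
    case ((n , q) , refl , refl) = Tof⊆Sof (map em n q)

  rooted : Rooted st
  rooted = lose (0 , init) (allCells-complete 0 init)
    ( trans (cong Sof (pres-init em)) (Sof-zeros dim)
    , trans (cong Tof (pres-init em)) (Tof-zeros dim))

  closedAt : ∀ n (q : Cell n) e → e ∈ Sof (map em n q) → e ∉ Tof (map em n q) →
    T (conf (Sof (map em n q)) (Tof (map em n q) ∪ ⁅ e ⁆)) × T (conf (Sof (map em n q) - e) (Tof (map em n q)))
  closedAt zero q e p np = ⊥-elim (noStar (map em 0 q) e p np)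
  closedAt (suc m) q e p np with findStar (map em (suc m) q) e p np
  ... | k , refl =
    lose (m , face tgt m k q) (allCells-complete m _)
      ( trans (cong Sof (comm em tgt m k q)) (Sof-tgt k (map em (suc m) q))
      , trans (cong Tof (comm em tgt m k q)) (Tof-tgt k (map em (suc m) q)))
    , lose (m , face src m k q) (allCells-complete m _)
      ( trans (cong Sof (comm em src m k q)) (Sof-src k (map em (suc m) q))
      , trans (cong Tof (comm em src m k q)) (Tof-src k (map em (suc m) q)))

  closed : ClosedSingle st
  closed S T' e p eS eT with witness S T' p
  ... | (n , q) , refl , refl = closedAt n q e eS eT

ST : Sculpture → OrdST
ST X = STCon.st X

ST-rooted : (X : Sculpture) → Rooted (ST X)
ST-rooted X = STCon.rooted X

ST-closed : (X : Sculpture) → ClosedSingle (ST X)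
ST-closed X = STCon.closed X

module Submission where

--  * Ordered ST-structures on the same events: if every configuration of A
--    is one of B, the identity on events is a bijective morphism A → B
--    (image-just makes the identity act trivially on configurations).
--    Every configuration of ST(Sc A) is of the form (S_c, T_c) for a tuple c
--    of Sc A, i.e. a configuration of A, so ST(Sc A) ≅ A.
--
--  * Sculptures in the same bulk B^d: if each embedded HDA covers the image
--    of the other, the embeddings induce mutually inverse HDA morphisms
--    (by injectivity), giving an isomorphism with the identity on B^d.
--    A tuple c is a cell of Sc(ST em) iff (S_c, T_c) = (S_{em q}, T_{em q})
--    for some cell q, and a tuple is determined by (S_c, T_c)
--    (tuple-determined), so Sc(ST em) and em have the same image.

open import Defs
open import Data.Nat using (ℕ; suc)
open import Data.Fin.Properties as FinP using ()
open import Data.Fin.Subset using (Subset; _⊆_)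
open import Data.Fin.Subset.Properties using (_∈?_)
open import Data.Vec as Vec using (lookup)
open import Data.Vec.Properties as VecP using ()
open import Data.Bool using (Bool; true; false; T)
open import Data.Maybe using (just)
open import Data.Maybe.Properties as MaybeP using ()
open import Data.Product using (Σ; _×_; _,_; proj₁; proj₂)
open import Data.Empty using (⊥-elim)
open import Relation.Binary.PropositionalEquality
open import Relation.Nullary using (yes; no)
open import Relation.Nullary.Decidable using (⌊_⌋; _×-dec_)

image-just : ∀ {d} (X : Subset d) → image just X ≡ X
image-just X = trans (VecP.tabulate-cong pointwise) (VecP.tabulate∘lookup X)
  where
  pointwise : ∀ e' →
    ⌊ FinP.any? (λ e → (e ∈? X) ×-dec MaybeP.≡-dec FinP._≟_ (just e) (just e')) ⌋ ≡ lookup X e'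
  pointwise e' with FinP.any? (λ e → (e ∈? X) ×-dec MaybeP.≡-dec FinP._≟_ (just e) (just e'))
  ... | yes (e , e∈X , refl) = sym (VecP.[]=⇒lookup e∈X)
  ... | no none with lookup X e' in eq
  ...   | false = refl
  ...   | true = ⊥-elim (none (e' , VecP.lookup⇒[]= e' X eq , refl))

inclusion-≅ST : ∀ {d} (C C' : Subset d → Subset d → Bool)
  (C-⊆ : ∀ X Y → T (C X Y) → Y ⊆ X) (C'-⊆ : ∀ X Y → T (C' X Y) → Y ⊆ X) →
  (∀ X Y → T (C X Y) → T (C' X Y)) →
  record { d = d ; Conf = C ; conf-⊆ = C-⊆ } ≅ST record { d = d ; Conf = C' ; conf-⊆ = C'-⊆ }
inclusion-≅ST {d} C C' C-⊆ C'-⊆ C⊆C' =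
  identity , (λ e → e , refl) , (λ { e₁ e₂ refl → refl }) , (λ e' → e' , refl)
  where
  identity : OrdSTHom record { d = d ; Conf = C ; conf-⊆ = C-⊆ }
                      record { d = d ; Conf = C' ; conf-⊆ = C'-⊆ }
  identity = record
    { fun = just
    ; total = λ X Y p e _ → e , refl
    ; inj = λ { X Y p e₁ e₂ _ _ refl → refl }
    ; conf = λ X Y p → subst₂ (λ U V → T (C' U V)) (sym (image-just X)) (sym (image-just Y))
                              (C⊆C' X Y p)
    ; mono = λ { e₁ e₂ _ _ lt refl refl → lt }
    }

ST-Sc-sound : (A : OrdST) (r : Rooted A) (cl : ClosedSingle A) →
  ∀ X Y → T (Conf (ST (Sc A r cl)) X Y) → T (Conf A X Y)
ST-Sc-sound A r cl X Y p with STCon.witness (Sc A r cl) X Y p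
... | (n , (c , c∈Sc)) , refl , refl = c∈Sc

tuple-determined : ∀ {d m n} (c : Cube d m) (c' : Cube d n) →
  Sof c ≡ Sof c' → Tof c ≡ Tof c' → _≡_ {A = Σ ℕ (Cube d)} (m , c) (n , c')
tuple-determined [] [] _ _ = refl
tuple-determined (c0 c) (c0 c') s t with tuple-determined c c' (cong Vec.tail s) (cong Vec.tail t)
... | refl = refl
tuple-determined (c⋆ c) (c⋆ c') s t with tuple-determined c c' (cong Vec.tail s) (cong Vec.tail t)
... | refl = refl
tuple-determined (c1 c) (c1 c') s t with tuple-determined c c' (cong Vec.tail s) (cong Vec.tail t)
... | refl = refl
tuple-determined (c0 c) (c⋆ c') () _
tuple-determined (c0 c) (c1 c') () _
tuple-determined (c⋆ c) (c0 c') () _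
tuple-determined (c⋆ c) (c1 c') _ ()
tuple-determined (c1 c) (c0 c') () _
tuple-determined (c1 c) (c⋆ c') _ ()

module SameBulk {d : ℕ} where

  Covers : ∀ {P Q : HDA} → HDAHom P (Bulk d) → HDAHom Q (Bulk d) → Set
  Covers {P} {Q} e e' = ∀ n (x : HDA.Cell P n) → Σ (HDA.Cell Q n) λ y → map e' n y ≡ map e n x

  -- When the image of e lies in that of the embedding e', the (unique)
  -- choice of preimages under e' is an HDA morphism: injectivity of e'
  -- transports the face and initial-cell equations from the bulk.
  lift : ∀ {P Q : HDA} (e : HDAHom P (Bulk d)) (e' : HDAHom Q (Bulk d)) →
    IsEmbedding e' → Covers e e' → HDAHom P Q
  lift {P} {Q} e e' e'-inj cov = record
    { map = λ n x → proj₁ (cov n x)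
    ; comm = λ α n k x → e'-inj n _ _ (begin
        map e' n (proj₁ (cov n (HDA.face P α n k x)))   ≡⟨ proj₂ (cov n _) ⟩
        map e n (HDA.face P α n k x)                     ≡⟨ comm e α n k x ⟩
        cface α k (map e (suc n) x)                      ≡⟨ cong (cface α k) (sym (proj₂ (cov _ x))) ⟩
        cface α k (map e' (suc n) (proj₁ (cov _ x)))     ≡⟨ sym (comm e' α n k _) ⟩
        map e' n (HDA.face Q α n k (proj₁ (cov _ x)))    ∎)
    ; pres-init = e'-inj 0 _ _
        (trans (proj₂ (cov 0 _)) (trans (pres-init e) (sym (pres-init e'))))
    }
    where open ≡-Reasoning

  identityBulk : HDAHom (Bulk d) (Bulk d)
  identityBulk = record { map = λ n c → c ; comm = λ α n k x → refl ; pres-init = refl }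

  same-image-≅Sc : ∀ {P Q : HDA}
    (e : HDAHom P (Bulk d)) (e-inj : IsEmbedding e)
    (e' : HDAHom Q (Bulk d)) (e'-inj : IsEmbedding e') →
    Covers e e' → Covers e' e →
    record { Q = P ; dim = d ; em = e ; em-inj = e-inj }
      ≅Sc record { Q = Q ; dim = d ; em = e' ; em-inj = e'-inj }
  same-image-≅Sc {P} {Q} e e-inj e' e'-inj cov cov' =
    record { f = to ; b = identityBulk ; comm = λ n x → sym (proj₂ (cov n x)) }
    , (from , (λ n x → e-inj n _ _ (trans (proj₂ (cov' n _)) (proj₂ (cov n x))))
            , (λ n y → e'-inj n _ _ (trans (proj₂ (cov n _)) (proj₂ (cov' n y)))))
    , (identityBulk , (λ n c → refl) , (λ n c → refl))
    where
    to : HDAHom P Q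
    to = lift e e' e'-inj cov
    from : HDAHom Q P
    from = lift e' e e-inj cov'

-- The cells of Sc(ST em) are exactly the tuples em q: each such tuple is a
-- cell, and conversely a cell c realizes a configuration (S_{em q}, T_{em q}),
-- so c = em q since tuples are determined by their configuration.
module ScST (X : Sculpture) where
  open Sculpture X
  open SameBulk using (Covers)

  ScSTem : HDAHom (Sculpture.Q (Sc (ST X) (ST-rooted X) (ST-closed X))) (Bulk dim)
  ScSTem = Sculpture.em (Sc (ST X) (ST-rooted X) (ST-closed X))

  Sc-covered : Covers ScSTem em
  Sc-covered n (c , c∈Sc) with STCon.witness X (Sof c) (Tof c) c∈Sc
  ... | (m , q) , s , t with tuple-determined (map em m q) c s t
  ... | refl = q , refl

  em-covered : Covers em ScSTem
  em-covered n q =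
    (map em n q , STCon.lose X (n , q) (STCon.allCells-complete X n q) (refl , refl)) , refl

theorem3p8 : ((A : OrdST) (r : Regular A) →
    ST (Sc A (Regular.rooted r) (Regular.closed r)) ≅ST A)
    ×
    ((X : Sculpture) → Sc (ST X) (ST-rooted X) (ST-closed X) ≅Sc X)
theorem3p8 = ST∘Sc , Sc∘ST
  where
  ST∘Sc : (A : OrdST) (r : Regular A) → ST (Sc A (Regular.rooted r) (Regular.closed r)) ≅ST A
  ST∘Sc A r = inclusion-≅ST _ (Conf A) _ (conf-⊆ A)
    (ST-Sc-sound A (Regular.rooted r) (Regular.closed r))

  Sc∘ST : (X : Sculpture) → Sc (ST X) (ST-rooted X) (ST-closed X) ≅Sc X
  Sc∘ST X = SameBulk.same-image-≅Sc (ScST.ScSTem X) _ (Sculpture.em X) (Sculpture.em-inj X)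
    (ScST.Sc-covered X) (ScST.em-covered X)
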